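{- For every $n\ge1$, the $\{\mathbf{3},\mathbf{2}+\mathbf{2}\}$-free naturally labelled posets on $[n]$ are in bijection with permutations $\sigma$ of $[n]$ each of whose entries is coloured blue or red, such that: the first entry $\sigma(1)$ is blue; there is no index $i$ with $\sigma(i),\sigma(i+1)$ both blue and $\sigma(i)<\sigma(i+1)$ (no blue-blue ascent); there is no index $i$ with $\sigma(i),\sigma(i+1)$ both red and $\sigma(i)>\sigma(i+1)$ (no red-red descent); and there are no indices $i<j$ with $\sigma(i)$ blue, $\sigma(j)$ red and $\sigma(i)>\sigma(j)$ (no blue–red inversion).
   Context: A partial order $\preceq$ on $[n]$ is naturally labelled if $x\prec y$ implies $x<y$. It is $\mathbf{3}$-free if it has no chain $x\prec y\prec z$, and $(\mathbf{2}+\mathbf{2})$-free if it has no induced subposet isomorphic to the disjoint union of two 2-element chains. -}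

module Defs where

open import Data.Nat using (ℕ; suc)
open import Data.Fin using (Fin; _<_; _>_)
import Data.Fin
import Data.Product
import Relation.Binary.PropositionalEquality
open import Data.Bool using (Bool; true; false; T)
open import Data.Vec using (Vec; lookup)
open import Data.Product using (Σ; _×_; _,_)
open import Relation.Nullary using (¬_)
open import Relation.Binary.PropositionalEquality using (_≡_; _≢_)

Rel : ℕ → Set
Rel n = Vec (Vec Bool n) n

_⊢_≼_ : ∀ {n} → Rel n → Fin n → Fin n → Set
R ⊢ x ≼ y = T (lookup (lookup R x) y)

_⊢_≺_ : ∀ {n} → Rel n → Fin n → Fin n → Set
R ⊢ x ≺ y = (R ⊢ x ≼ y) × (x ≢ y)

record IsPartialOrder {n : ℕ} (R : Rel n) : Set where
  field
    refl  : ∀ x → R ⊢ x ≼ x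
    antisym : ∀ x y → R ⊢ x ≼ y → R ⊢ y ≼ x → x ≡ y
    trans : ∀ x y z → R ⊢ x ≼ y → R ⊢ y ≼ z → R ⊢ x ≼ z

NaturallyLabelled : ∀ {n} → Rel n → Set
NaturallyLabelled R = ∀ x y → R ⊢ x ≺ y → x < y

ThreeFree : ∀ {n} → Rel n → Set
ThreeFree R = ∀ x y z → ¬ ((R ⊢ x ≺ y) × (R ⊢ y ≺ z))

_⊢_∥_ : ∀ {n} → Rel n → Fin n → Fin n → Set
R ⊢ x ∥ y = ¬ (R ⊢ x ≼ y) × ¬ (R ⊢ y ≼ x)

-- (2+2)-free: no a ≺ b, c ≺ d with {a,b} and {c,d} pairwise incomparable
-- (an induced copy of the disjoint union of two 2-element chains)
TwoPlusTwoFree : ∀ {n} → Rel n → Set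
TwoPlusTwoFree R = ∀ a b c d →
  ¬ ((R ⊢ a ≺ b) × (R ⊢ c ≺ d) ×
     (R ⊢ a ∥ c) × (R ⊢ a ∥ d) × (R ⊢ b ∥ c) × (R ⊢ b ∥ d))

record Is32Poset {n : ℕ} (R : Rel n) : Set where
  field
    partialOrder : IsPartialOrder R
    natural      : NaturallyLabelled R
    threeFree    : ThreeFree R
    twoTwoFree   : TwoPlusTwoFree R

-- Coloured permutations: σ in one-line notation (σ(1),…,σ(n)) as a vector,
-- together with a colouring of the entries: true = blue, false = red.
-- The colour of the entry σ(i) is stored at position i.
ColPerm : ℕ → Set
ColPerm n = Vec (Fin n) n × Vec Bool n

IsPermutation : ∀ {n} → Vec (Fin n) n → Set
IsPermutation {n} σ = ∀ i j → lookup σ i ≡ lookup σ j → i ≡ j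

Blue Red : Bool → Set
Blue c = c ≡ true
Red c = c ≡ false

record IsValidColPerm {n : ℕ} (p : ColPerm n) : Set where
  σ : Vec (Fin n) n
  σ = Data.Product.proj₁ p
  col : Vec Bool n
  col = Data.Product.proj₂ p
  field
    perm : IsPermutation σ
    firstBlue : ∀ {m} → (e : n ≡ suc m) → Blue (lookup col (Data.Fin.cast (Relation.Binary.PropositionalEquality.sym e) Data.Fin.zero))
    noBBAscent : ∀ (i : Fin n) (i' : Fin n) → Data.Fin.toℕ i' ≡ suc (Data.Fin.toℕ i) →
      ¬ (Blue (lookup col i) × Blue (lookup col i') × lookup σ i < lookup σ i')
    noRRDescent : ∀ (i : Fin n) (i' : Fin n) → Data.Fin.toℕ i' ≡ suc (Data.Fin.toℕ i) →
      ¬ (Red (lookup col i) × Red (lookup col i') × lookup σ i > lookup σ i')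
    noBRInversion : ∀ (i j : Fin n) → i < j →
      ¬ (Blue (lookup col i) × Red (lookup col j) × lookup σ i > lookup σ j)

-- The two sets, as setoids whose equality is equality of the underlying data
-- (the relation matrix, resp. the pair (σ, colouring)); the property proofs
-- are ignored.
open import Relation.Binary.Bundles using (Setoid)
open import Relation.Binary.PropositionalEquality using (setoid)
import Relation.Binary.Construct.On as On
open import Level using (0ℓ)

PosetSetoid : ℕ → Setoid 0ℓ 0ℓ
PosetSetoid n = On.setoid {B = Σ (Rel n) Is32Poset} (setoid (Rel n)) Data.Product.proj₁

ColPermSetoid : ℕ → Setoid 0ℓ 0ℓ
ColPermSetoid n = On.setoid {B = Σ (ColPerm n) IsValidColPerm} (setoid (ColPerm n)) Data.Product.proj₁

-- Colour the minimal elements of a {3, 2+2}-free poset blue and the others red.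
-- Since (2+2)-freeness makes up-sets (and down-sets) totally ordered by inclusion, the
-- following is a strict total order: minimal elements by decreasing up-set, non-minimal
-- ones by increasing down-set, ties broken by decreasing resp. increasing label, and a
-- minimal x precedes a non-minimal y iff x ≺ y.  Listing the poset in this order gives
-- the coloured permutation; natural labelling forbids blue-red inversions, and an
-- ascent between adjacent blue (descent between adjacent red) entries would force an
-- element strictly between them.  Conversely, a coloured permutation gives the poset in
-- which x ≺ y iff x occurs blue before y occurs red; the four conditions make the
-- permutation strictly increasing for the order above, and a finite strict total order
-- has only one strictly increasing enumeration, so the two maps are mutually inverse.

{-# OPTIONS --safe #-}
module Submission where

open import Defs
open import Data.Nat using (ℕ; _≥_)
open import Function.Bundles using (Bijection)

import Data.Bool.Properties as BoolP
import Data.Nat as ℕ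
import Data.Nat.Properties as ℕP
import Data.List.Properties as ListP
import Data.List.Relation.Binary.Permutation.Propositional as Perm
import Data.List.Relation.Binary.Permutation.Propositional.Properties as PermP
import Data.List.Relation.Binary.Permutation.Setoid.Properties as PermSP
import Data.List.Relation.Unary.Any as Any
import Data.List.Relation.Unary.Any.Properties as AnyP
import Data.List.Relation.Unary.Sorted.TotalOrder.Properties as SortedP
import Data.List.Relation.Unary.Unique.Propositional.Properties as UniqueP
import Data.List.Sort as Sort
import Data.Sum as Sum
import Data.Vec.Properties as VecP
import Relation.Binary.Construct.StrictToNonStrict as StrictToNonStrict
open import Data.Bool using (Bool; true; false; T; not)
open import Data.Empty using (⊥; ⊥-elim)
open import Data.Fin using (Fin; toℕ; _<_; _≤_; _≟_; cast; inject₁; punchOut)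
open import Data.Fin.Induction using (<-wellFounded)
open import Data.Fin.Properties
  using (any?; _≤?_; _<?_; <-cmp; <-irrefl; <-asym; <-trans; ≤∧≢⇒<; <⇒≢; toℕ-injective; toℕ-cast;
         toℕ-inject₁; cast-involutive; pigeonhole; punchOut-injective)
import Data.List
open import Data.List using (List; length; allFin)
open import Data.List.Membership.Propositional.Properties using (∈-lookup; ∈-allFin)
import Data.List.Relation.Unary.All as All
open import Data.List.Relation.Unary.AllPairs using (_∷_)
open import Data.List.Relation.Unary.Unique.Propositional using (Unique)
open import Data.Nat using (zero; suc)
open import Data.Product using (∃; ∃₂; _×_; _,_; proj₁; proj₂)
open import Data.Sum using (_⊎_; inj₁; inj₂)
open import Data.Vec using (lookup; tabulate)
open import Function using (_∘_; mk⇔)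
open import Function.Bundles using (Inverse)
open import Function.Properties.Inverse using (Inverse⇒Bijection)
open import Induction.WellFounded using (Acc; acc)
open import Level using (0ℓ)
open import Relation.Binary.Bundles using (DecTotalOrder)
open import Relation.Binary.Core using (_Preserves_⟶_)
open import Relation.Binary.Definitions using (Irreflexive; Transitive; Trichotomous; tri<; tri≈; tri>)
open import Relation.Binary.Structures using (IsStrictTotalOrder)
open import Relation.Binary.PropositionalEquality
  using (_≡_; _≢_; refl; sym; trans; cong; cong₂; subst; subst₂; setoid; isEquivalence; resp₂;
         module ≡-Reasoning)
open import Relation.Nullary using (¬_; Dec; yes; no; ¬?; does)
open import Relation.Nullary.Decidable
  using (_×-dec_; _⊎-dec_; toWitness; fromWitness; isYes; isYes≗does; T?; dec-true; dec-false;
         does-⇔; decidable-stable)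

injective⇒surjective : ∀ {n} (f : Fin n → Fin n) → (∀ {i j} → f i ≡ f j → i ≡ j) →
                       ∀ y → ∃ λ i → f i ≡ y
injective⇒surjective {zero}  f f-inj ()
injective⇒surjective {suc m} f f-inj y with any? (λ i → f i ≟ y)
... | yes hit = hit
... | no miss
  with i , j , i<j , eq ← pigeonhole (ℕP.n<1+n m) (λ i → punchOut (miss ∘ (i ,_) ∘ sym))
  = ⊥-elim (<⇒≢ i<j (f-inj (punchOut-injective (miss ∘ (i ,_) ∘ sym) (miss ∘ (j ,_) ∘ sym) eq)))

inhabited⇒suc : ∀ {n} → Fin n → ∃ λ m → n ≡ suc m
inhabited⇒suc Fin.zero    = _ , refl
inhabited⇒suc (Fin.suc _) = _ , refl

Unique-lookup-injective : ∀ {A : Set} {xs : List A} → Unique xs →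
                          ∀ {i j} → Data.List.lookup xs i ≡ Data.List.lookup xs j → i ≡ j
Unique-lookup-injective (_  ∷ _)   {Fin.zero}  {Fin.zero}  _  = refl
Unique-lookup-injective (x∉ ∷ _)   {Fin.zero}  {Fin.suc j} eq = ⊥-elim (All.lookup x∉ (∈-lookup j) eq)
Unique-lookup-injective (x∉ ∷ _)   {Fin.suc i} {Fin.zero}  eq = ⊥-elim (All.lookup x∉ (∈-lookup i) (sym eq))
Unique-lookup-injective (_  ∷ xs!) {Fin.suc i} {Fin.suc j} eq = cong Fin.suc (Unique-lookup-injective xs! eq)

module _ {n} {_⊏_ : Fin n → Fin n → Set}
         (⊏-irrefl : Irreflexive _≡_ _⊏_) (⊏-trans : Transitive _⊏_) where

  strictlyMonotone-reflects : ∀ {f : Fin n → Fin n} → f Preserves _<_ ⟶ _⊏_ →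
                              ∀ {i j} → f i ⊏ f j → i < j
  strictlyMonotone-reflects {f} mono {i} {j} fi⊏fj with <-cmp i j
  ... | tri< i<j _ _ = i<j
  ... | tri≈ _ refl _ = ⊥-elim (⊏-irrefl {f i} refl fi⊏fj)
  ... | tri> _ _ j<i = ⊥-elim (⊏-irrefl {f i} refl (⊏-trans fi⊏fj (mono j<i)))

  strictlyMonotone⇒injective : ∀ {f : Fin n → Fin n} → f Preserves _<_ ⟶ _⊏_ →
                               ∀ {i j} → f i ≡ f j → i ≡ j
  strictlyMonotone⇒injective {f} mono {i} {j} fi≡fj with <-cmp i j
  ... | tri< i<j _ _ = ⊥-elim (⊏-irrefl fi≡fj (mono i<j))
  ... | tri≈ _ i≡j _ = i≡j
  ... | tri> _ _ j<i = ⊥-elim (⊏-irrefl (sym fi≡fj) (mono j<i))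

  strictlyMonotone-surjections-agree :
    ∀ {f g : Fin n → Fin n} → f Preserves _<_ ⟶ _⊏_ → (∀ y → ∃ λ i → f i ≡ y) →
                              g Preserves _<_ ⟶ _⊏_ → (∀ y → ∃ λ i → g i ≡ y) → ∀ i → f i ≡ g i
  strictlyMonotone-surjections-agree {f} {g} f-mono f-onto g-mono g-onto i = agree (<-wellFounded i)
    where
    agree : ∀ {i} → Acc _<_ i → f i ≡ g i
    agree {i} (acc below) with g-onto (f i) | f-onto (g i)
    ... | k , gk≡fi | m , fm≡gi with <-cmp k i | <-cmp m i
    ... | tri≈ _ refl _ | _ = sym gk≡fi
    ... | _ | tri≈ _ refl _ = fm≡gi
    ... | tri< k<i _ _ | _ =
      ⊥-elim (<⇒≢ k<i (strictlyMonotone⇒injective f-mono (trans (agree (below k<i)) gk≡fi)))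
    ... | _ | tri< m<i _ _ =
      ⊥-elim (<⇒≢ m<i (strictlyMonotone⇒injective g-mono (trans (sym (agree (below m<i))) fm≡gi)))
    ... | tri> _ _ i<k | tri> _ _ i<m =
      ⊥-elim (⊏-irrefl {g i} refl (⊏-trans (subst (g i ⊏_) gk≡fi (g-mono i<k))
                                           (subst (f i ⊏_) fm≡gi (f-mono i<m))))

Adjacent : ∀ {n} → Fin n → Fin n → Set
Adjacent i j = toℕ j ≡ suc (toℕ i)

adjacent⇒< : ∀ {n} {i j : Fin n} → Adjacent i j → i < j
adjacent⇒< {i = i} i⋖j = subst (toℕ i ℕ.<_) (sym i⋖j) (ℕP.n<1+n _)

predecessor : ∀ {n} {i j : Fin n} → i < j → ∃ λ k → Adjacent k j × i ≤ k
predecessor {j = Fin.zero} ()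
predecessor {j = Fin.suc j} (ℕ.s≤s i≤j) =
  inject₁ j , cong suc (sym (toℕ-inject₁ j)) , subst (_ ℕ.≤_) (sym (toℕ-inject₁ j)) i≤j

module _ {n} (P : Fin n → Set) {_⊏_ : Fin n → Fin n → Set} (⊏-trans : Transitive _⊏_)
         (adjacent : ∀ {i j} → Adjacent i j → P i → P j → i ⊏ j) where

  chain : ∀ {i j} → i < j → (∀ {k} → i ≤ k → k ≤ j → P k) → i ⊏ j
  chain {i} {j} i<j = go (<-wellFounded j) i<j
    where
    go : ∀ {j} → Acc _<_ j → i < j → (∀ {k} → i ≤ k → k ≤ j → P k) → i ⊏ j
    go {j} (acc below) i<j inside with predecessor i<j
    ... | k , k⋖j , i≤k with i ≟ k | adjacent⇒< k⋖j
    ...   | yes refl | k<j = adjacent k⋖j (inside i≤k (ℕP.<⇒≤ k<j)) (inside (ℕP.<⇒≤ i<j) ℕP.≤-refl)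
    ...   | no i≢k   | k<j =
      ⊏-trans (go (below k<j) (≤∧≢⇒< i≤k i≢k)
                  (λ i≤l l≤k → inside i≤l (ℕP.≤-trans l≤k (ℕP.<⇒≤ k<j))))
              (adjacent k⋖j (inside i≤k (ℕP.<⇒≤ k<j)) (inside (ℕP.<⇒≤ i<j) ℕP.≤-refl))

data Wider {n} (S : Fin n → Fin n → Set) (x y : Fin n) : Set where
  strictly : ∀ u → S x u → ¬ S y u → Wider S x y
  equally  : (∀ u → S x u → S y u) → (∀ u → S y u → S x u) → y < x → Wider S x y

module WiderProperties {n} {S : Fin n → Fin n → Set}
                       (nested : ∀ {x y u v} → S x u → ¬ S y u → S y v → S x v) where

  wider-irrefl : ∀ {x} → ¬ Wider S x x
  wider-irrefl (strictly u xu ¬xu) = ¬xu xu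
  wider-irrefl (equally _ _ x<x)   = <-irrefl refl x<x

  wider-⊇ : ∀ {x y v} → Wider S x y → S y v → S x v
  wider-⊇ (strictly u xu ¬yu) yv = nested xu ¬yu yv
  wider-⊇ (equally _ y⊆x _)   yv = y⊆x _ yv

  wider-trans : ∀ {x y z} → Wider S x y → Wider S y z → Wider S x z
  wider-trans (strictly u xu ¬yu) (strictly v yv ¬zv) = strictly v (nested xu ¬yu yv) ¬zv
  wider-trans (strictly u xu ¬yu) (equally _ z⊆y _)   = strictly u xu (¬yu ∘ z⊆y u)
  wider-trans (equally _ y⊆x _)   (strictly v yv ¬zv) = strictly v (y⊆x v yv) ¬zv
  wider-trans (equally x⊆y y⊆x y<x) (equally y⊆z z⊆y z<y) =
    equally (λ u → y⊆z u ∘ x⊆y u) (λ u → y⊆x u ∘ z⊆y u) (<-trans z<y y<x)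

  module _ (S? : ∀ x u → Dec (S x u)) where

    ¬⊈⇒⊆ : ∀ {x y} → ¬ (∃ λ u → S x u × ¬ S y u) → ∀ u → S x u → S y u
    ¬⊈⇒⊆ {y = y} x⊈y u xu = decidable-stable (S? y u) (λ ¬yu → x⊈y (u , xu , ¬yu))

    wider-total : ∀ {x y} → x ≢ y → Wider S x y ⊎ Wider S y x
    wider-total {x} {y} x≢y with any? (λ u → S? x u ×-dec ¬? (S? y u))
    ... | yes (u , xu , ¬yu) = inj₁ (strictly u xu ¬yu)
    ... | no x⊈y with any? (λ u → S? y u ×-dec ¬? (S? x u))
    ...   | yes (u , yu , ¬xu) = inj₂ (strictly u yu ¬xu)
    ...   | no y⊈x with <-cmp x y
    ...     | tri< x<y _ _ = inj₂ (equally (¬⊈⇒⊆ y⊈x) (¬⊈⇒⊆ x⊈y) x<y)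
    ...     | tri≈ _ x≡y _ = ⊥-elim (x≢y x≡y)
    ...     | tri> _ _ y<x = inj₁ (equally (¬⊈⇒⊆ x⊈y) (¬⊈⇒⊆ y⊈x) y<x)

module Structure {n} (R : Rel n) where

  _≺?_ : ∀ x y → Dec (R ⊢ x ≺ y)
  x ≺? y = T? (lookup (lookup R x) y) ×-dec ¬? (x ≟ y)

  ≼⇒≡⊎≺ : ∀ {x y} → R ⊢ x ≼ y → x ≡ y ⊎ R ⊢ x ≺ y
  ≼⇒≡⊎≺ {x} {y} x≼y with x ≟ y
  ... | yes x≡y = inj₁ x≡y
  ... | no x≢y  = inj₂ (x≼y , x≢y)

  NonMinimal : Fin n → Set
  NonMinimal x = ∃ λ w → R ⊢ w ≺ x

  nonMinimal? : ∀ x → Dec (NonMinimal x)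
  nonMinimal? x = any? (λ w → w ≺? x)

  colour : Fin n → Bool
  colour x = not (does (nonMinimal? x))

  minimal⇒blue : ∀ {x} → ¬ NonMinimal x → Blue (colour x)
  minimal⇒blue {x} min = cong not (dec-false (nonMinimal? x) min)

  nonMinimal⇒red : ∀ {x} → NonMinimal x → Red (colour x)
  nonMinimal⇒red {x} nonmin = cong not (dec-true (nonMinimal? x) nonmin)

  blue⇒minimal : ∀ {x} → Blue (colour x) → ¬ NonMinimal x
  blue⇒minimal {x} with nonMinimal? x
  ... | yes _   = λ ()
  ... | no  min = λ _ → min

  red⇒nonMinimal : ∀ {x} → Red (colour x) → NonMinimal x
  red⇒nonMinimal {x} with nonMinimal? x
  ... | yes nonmin = λ _ → nonmin
  ... | no  _      = λ ()

  -- In a 3-free poset these are the only comparabilities possible between the chains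
  -- a ≺ b and c ≺ d, so Crossing is (2+2)-freeness.
  Crossing : Set
  Crossing = ∀ {a b c d} → R ⊢ a ≺ b → R ⊢ c ≺ d → a ≡ c ⊎ b ≡ d ⊎ R ⊢ a ≺ d ⊎ R ⊢ c ≺ b

  crossing⇒twoTwoFree : (∀ x → R ⊢ x ≼ x) → Crossing → TwoPlusTwoFree R
  crossing⇒twoTwoFree ≼-refl cross a b c d (a≺b , c≺d , (a⋠c , _) , (a⋠d , _) , (_ , c⋠b) , (b⋠d , _))
    with cross a≺b c≺d
  ... | inj₁ refl                = a⋠c (≼-refl a)
  ... | inj₂ (inj₁ refl)         = b⋠d (≼-refl b)
  ... | inj₂ (inj₂ (inj₁ a≺d))   = a⋠d (proj₁ a≺d)
  ... | inj₂ (inj₂ (inj₂ c≺b))   = c⋠b (proj₁ c≺b)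

  Up Down : Fin n → Fin n → Set
  Up x u = R ⊢ x ≺ u
  Down x w = R ⊢ w ≺ x

  data Before (x y : Fin n) : Set where
    blue-blue : ¬ NonMinimal x → ¬ NonMinimal y → Wider Up x y → Before x y
    blue-red  : ¬ NonMinimal x → NonMinimal y → R ⊢ x ≺ y → Before x y
    red-blue  : NonMinimal x → ¬ NonMinimal y → ¬ R ⊢ y ≺ x → Before x y
    red-red   : NonMinimal x → NonMinimal y → Wider Down y x → Before x y

  before-blue-red⇒≺ : ∀ {x y} → Before x y → ¬ NonMinimal x → NonMinimal y → R ⊢ x ≺ y
  before-blue-red⇒≺ (blue-blue _ min _)    _   nonmin = ⊥-elim (min nonmin)
  before-blue-red⇒≺ (blue-red _ _ x≺y)     _   _      = x≺y
  before-blue-red⇒≺ (red-blue nonmin _ _)  min _      = ⊥-elim (min nonmin)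
  before-blue-red⇒≺ (red-red nonmin _ _)   min _      = ⊥-elim (min nonmin)

  module Properties (pf : Is32Poset R) where
    open Is32Poset pf

    no-chain : ∀ {x y z} → R ⊢ x ≺ y → R ⊢ y ≺ z → ⊥
    no-chain x≺y y≺z = threeFree _ _ _ (x≺y , y≺z)

    ≺⇒minimal : ∀ {x y} → R ⊢ x ≺ y → ¬ NonMinimal x
    ≺⇒minimal x≺y (w , w≺x) = no-chain w≺x x≺y

    ≺-cross : Crossing
    ≺-cross {a} {b} {c} {d} a≺b c≺d with a ≟ c | b ≟ d | a ≺? d | c ≺? b
    ... | yes a≡c | _       | _       | _       = inj₁ a≡c
    ... | no _    | yes b≡d | _       | _       = inj₂ (inj₁ b≡d)
    ... | no _    | no _    | yes a≺d | _       = inj₂ (inj₂ (inj₁ a≺d))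
    ... | no _    | no _    | no _    | yes c≺b = inj₂ (inj₂ (inj₂ c≺b))
    ... | no a≢c  | no b≢d  | no a⊀d  | no c⊀b  = ⊥-elim (twoTwoFree a b c d
          (a≺b , c≺d
          , (⋠ a≢c (λ a≺c → no-chain a≺c c≺d) , ⋠ (a≢c ∘ sym) (λ c≺a → no-chain c≺a a≺b))
          , (⋠ a≢d a⊀d                        , ⋠ (a≢d ∘ sym) (λ d≺a → no-chain c≺d d≺a))
          , (⋠ b≢c (λ b≺c → no-chain a≺b b≺c) , ⋠ (b≢c ∘ sym) c⊀b)
          , (⋠ b≢d (λ b≺d → no-chain a≺b b≺d) , ⋠ (b≢d ∘ sym) (λ d≺b → no-chain c≺d d≺b))))
      where
      ⋠ : ∀ {x y} → x ≢ y → ¬ R ⊢ x ≺ y → ¬ R ⊢ x ≼ y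
      ⋠ x≢y x⊀y x≼y = x⊀y (x≼y , x≢y)
      a≢d : a ≢ d
      a≢d refl = no-chain c≺d a≺b
      b≢c : b ≢ c
      b≢c refl = no-chain a≺b c≺d

    upsets-nested : ∀ {x y u v} → R ⊢ x ≺ u → ¬ R ⊢ y ≺ u → R ⊢ y ≺ v → R ⊢ x ≺ v
    upsets-nested x≺u y⊀u y≺v with ≺-cross x≺u y≺v
    ... | inj₁ refl              = ⊥-elim (y⊀u x≺u)
    ... | inj₂ (inj₁ refl)       = x≺u
    ... | inj₂ (inj₂ (inj₁ x≺v)) = x≺v
    ... | inj₂ (inj₂ (inj₂ y≺u)) = ⊥-elim (y⊀u y≺u)

    downsets-nested : ∀ {x y u v} → R ⊢ u ≺ x → ¬ R ⊢ u ≺ y → R ⊢ v ≺ y → R ⊢ v ≺ x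
    downsets-nested u≺x u⊀y v≺y with ≺-cross u≺x v≺y
    ... | inj₁ refl              = ⊥-elim (u⊀y v≺y)
    ... | inj₂ (inj₁ refl)       = v≺y
    ... | inj₂ (inj₂ (inj₁ u≺y)) = ⊥-elim (u⊀y u≺y)
    ... | inj₂ (inj₂ (inj₂ v≺x)) = v≺x

    module ↑ = WiderProperties {S = Up} upsets-nested
    module ↓ = WiderProperties {S = Down} downsets-nested

    ≺⇒before : ∀ {x y} → R ⊢ x ≺ y → Before x y
    ≺⇒before x≺y = blue-red (≺⇒minimal x≺y) (_ , x≺y) x≺y

    before-irrefl : ∀ {x} → ¬ Before x x
    before-irrefl (blue-blue _ _ x>x)     = ↑.wider-irrefl x>x
    before-irrefl (blue-red min nonmin _) = min nonmin
    before-irrefl (red-blue nonmin min _) = min nonmin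
    before-irrefl (red-red _ _ x>x)       = ↓.wider-irrefl x>x

    before-irreflexive : Irreflexive _≡_ Before
    before-irreflexive refl = before-irrefl

    before-trans : ∀ {x y z} → Before x y → Before y z → Before x z
    before-trans (blue-blue mx _ x>y)   (blue-blue _ mz y>z)   = blue-blue mx mz (↑.wider-trans x>y y>z)
    before-trans (blue-blue mx _ x>y)   (blue-red _ nz y≺z)    = blue-red mx nz (↑.wider-⊇ x>y y≺z)
    before-trans (blue-red mx _ x≺y)    (red-blue _ mz z⊀y)    = blue-blue mx mz (strictly _ x≺y z⊀y)
    before-trans (blue-red mx _ x≺y)    (red-red _ nz z>y)     = blue-red mx nz (↓.wider-⊇ z>y x≺y)
    before-trans (red-blue nx _ y⊀x)    (blue-blue _ mz y>z)   = red-blue nx mz (y⊀x ∘ ↑.wider-⊇ y>z)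
    before-trans (red-blue nx _ y⊀x)    (blue-red _ nz y≺z)    = red-red nx nz (strictly _ y≺z y⊀x)
    before-trans (red-red nx _ y>x)     (red-blue _ mz z⊀y)    = red-blue nx mz (z⊀y ∘ ↓.wider-⊇ y>x)
    before-trans (red-red nx _ y>x)     (red-red _ nz z>y)     = red-red nx nz (↓.wider-trans z>y y>x)
    before-trans (blue-blue _ my _)     (red-blue ny _ _)      = ⊥-elim (my ny)
    before-trans (blue-blue _ my _)     (red-red ny _ _)       = ⊥-elim (my ny)
    before-trans (blue-red _ ny _)      (blue-blue my _ _)     = ⊥-elim (my ny)
    before-trans (blue-red _ ny _)      (blue-red my _ _)      = ⊥-elim (my ny)
    before-trans (red-blue _ my _)      (red-blue ny _ _)      = ⊥-elim (my ny)
    before-trans (red-blue _ my _)      (red-red ny _ _)       = ⊥-elim (my ny)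
    before-trans (red-red _ ny _)       (blue-blue my _ _)     = ⊥-elim (my ny)
    before-trans (red-red _ ny _)       (blue-red my _ _)      = ⊥-elim (my ny)

    before-total : ∀ {x y} → x ≢ y → Before x y ⊎ Before y x
    before-total {x} {y} x≢y with nonMinimal? x | nonMinimal? y
    ... | no mx  | no my  =
      Sum.map (blue-blue mx my) (blue-blue my mx) (↑.wider-total (λ x u → x ≺? u) x≢y)
    ... | yes nx | yes ny =
      Sum.map (red-red nx ny) (red-red ny nx) (↓.wider-total (λ x w → w ≺? x) (x≢y ∘ sym))
    ... | no mx  | yes ny with x ≺? y
    ...   | yes x≺y = inj₁ (blue-red mx ny x≺y)
    ...   | no x⊀y  = inj₂ (red-blue ny mx x⊀y)
    before-total {x} {y} x≢y | yes nx | no my with y ≺? x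
    ...   | yes y≺x = inj₂ (blue-red my nx y≺x)
    ...   | no y⊀x  = inj₁ (red-blue nx my y⊀x)

    before-compare : Trichotomous _≡_ Before
    before-compare x y with x ≟ y
    ... | yes refl = tri≈ before-irrefl refl before-irrefl
    ... | no x≢y with before-total x≢y
    ...   | inj₁ x<y = tri< x<y x≢y (before-irrefl ∘ before-trans x<y)
    ...   | inj₂ y<x = tri> (before-irrefl ∘ before-trans y<x) x≢y y<x

    before-isStrictTotalOrder : IsStrictTotalOrder _≡_ Before
    before-isStrictTotalOrder = record
      { isStrictPartialOrder = record
        { isEquivalence = isEquivalence
        ; irrefl        = before-irreflexive
        ; trans         = before-trans
        ; <-resp-≈      = resp₂ Before }
      ; compare = before-compare }

module Reading {n} (R : Rel n) (pf : Is32Poset R) where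
  open Structure R
  open Properties pf
  open Is32Poset pf using (natural)

  decTotalOrder : DecTotalOrder 0ℓ 0ℓ 0ℓ
  decTotalOrder = record
    { isDecTotalOrder = StrictToNonStrict.isDecTotalOrder _≡_ Before before-isStrictTotalOrder }

  open Sort decTotalOrder using (sort; sort-↭; sort-↗)

  sorted : List (Fin n)
  sorted = sort (allFin n)

  length-sorted : length sorted ≡ n
  length-sorted = trans (PermP.↭-length (sort-↭ (allFin n))) (ListP.length-tabulate (λ i → i))

  position : Fin n → Fin (length sorted)
  position = cast (sym length-sorted)

  toℕ-position : ∀ i → toℕ (position i) ≡ toℕ i
  toℕ-position = toℕ-cast (sym length-sorted)

  reading : Fin n → Fin n
  reading i = Data.List.lookup sorted (position i)

  sorted-unique : Unique sorted
  sorted-unique = PermSP.Unique-resp-↭ (setoid (Fin n)) (Perm.↭⇒↭ₛ (Perm.↭-sym (sort-↭ (allFin n))))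
                                       (UniqueP.allFin⁺ n)

  reading-injective : ∀ {i j} → reading i ≡ reading j → i ≡ j
  reading-injective {i} {j} eq = toℕ-injective (begin
    toℕ i            ≡⟨ toℕ-position i ⟨
    toℕ (position i) ≡⟨ cong toℕ (Unique-lookup-injective sorted-unique eq) ⟩
    toℕ (position j) ≡⟨ toℕ-position j ⟩
    toℕ j            ∎)
    where open ≡-Reasoning

  reading-surjective : ∀ y → ∃ λ i → reading i ≡ y
  reading-surjective y =
    cast length-sorted k ,
    trans (cong (Data.List.lookup sorted) (cast-involutive (sym length-sorted) length-sorted k))
          (sym (AnyP.lookup-index y∈sorted))
    where
    y∈sorted = PermP.Any-resp-↭ (Perm.↭-sym (sort-↭ (allFin n))) (∈-allFin y)
    k = Any.index y∈sorted

  reading-monotone : reading Preserves _<_ ⟶ Before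
  reading-monotone {i} {j} i<j
    with SortedP.lookup-mono-≤ (DecTotalOrder.totalOrder decTotalOrder) (sort-↗ (allFin n))
           (subst₂ ℕ._≤_ (sym (toℕ-position i)) (sym (toℕ-position j)) (ℕP.<⇒≤ i<j))
  ... | inj₁ before = before
  ... | inj₂ eq     = ⊥-elim (<⇒≢ i<j (reading-injective eq))

  reading-reflects : ∀ {i j} → Before (reading i) (reading j) → i < j
  reading-reflects = strictlyMonotone-reflects before-irreflexive before-trans {reading} reading-monotone

  reading-unique : ∀ {f : Fin n → Fin n} → f Preserves _<_ ⟶ Before → (∀ y → ∃ λ i → f i ≡ y) →
                   ∀ i → reading i ≡ f i
  reading-unique =
    strictlyMonotone-surjections-agree before-irreflexive before-trans reading-monotone reading-surjective

  no-element-between : ∀ {i j u} → Adjacent i j → Before (reading i) u → Before u (reading j) → ⊥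
  no-element-between {i} {j} {u} i⋖j i<u u<j with reading-surjective u
  ... | k , refl = ℕP.<-irrefl refl
    (ℕP.<-≤-trans (reading-reflects i<u) (ℕP.≤-pred (subst (toℕ k ℕ.<_) i⋖j (reading-reflects u<j))))

  first-minimal : ∀ z → toℕ z ≡ 0 → ¬ NonMinimal (reading z)
  first-minimal z z≡0 (w , w≺z) with reading-surjective w
  ... | k , refl = ℕP.n≮0 (subst (toℕ k ℕ.<_) z≡0 (reading-reflects (≺⇒before w≺z)))

  minimal-adjacent-descent : ∀ {i j} → Adjacent i j → ¬ NonMinimal (reading i) → ¬ NonMinimal (reading j) →
                             reading j < reading i
  minimal-adjacent-descent i⋖j mi mj with reading-monotone (adjacent⇒< i⋖j)
  ... | blue-blue _ _ (strictly _ x≺u y⊀u) =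
    ⊥-elim (no-element-between i⋖j (≺⇒before x≺u) (red-blue (_ , x≺u) mj y⊀u))
  ... | blue-blue _ _ (equally _ _ y<x)    = y<x
  ... | blue-red _ nj _                    = ⊥-elim (mj nj)
  ... | red-blue ni _ _                    = ⊥-elim (mi ni)
  ... | red-red ni _ _                     = ⊥-elim (mi ni)

  nonMinimal-adjacent-ascent : ∀ {i j} → Adjacent i j → NonMinimal (reading i) → NonMinimal (reading j) →
                               reading i < reading j
  nonMinimal-adjacent-ascent i⋖j ni nj with reading-monotone (adjacent⇒< i⋖j)
  ... | red-red _ _ (strictly _ u≺y u⊀x) =
    ⊥-elim (no-element-between i⋖j (red-blue ni (≺⇒minimal u≺y) u⊀x) (≺⇒before u≺y))
  ... | red-red _ _ (equally _ _ x<y)    = x<y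
  ... | blue-blue mi _ _                 = ⊥-elim (mi ni)
  ... | blue-red mi _ _                  = ⊥-elim (mi ni)
  ... | red-blue _ mj _                  = ⊥-elim (mj nj)

  minimal-before-nonMinimal : ∀ {i j} → i < j → ¬ NonMinimal (reading i) → NonMinimal (reading j) →
                              reading i < reading j
  minimal-before-nonMinimal i<j mi nj = natural _ _ (before-blue-red⇒≺ (reading-monotone i<j) mi nj)

  toColPerm : ColPerm n
  toColPerm = tabulate reading , tabulate (colour ∘ reading)

  lookup-σ : ∀ i → lookup (proj₁ toColPerm) i ≡ reading i
  lookup-σ = VecP.lookup∘tabulate reading

  lookup-κ : ∀ i → lookup (proj₂ toColPerm) i ≡ colour (reading i)
  lookup-κ = VecP.lookup∘tabulate (colour ∘ reading)

  toColPerm-valid : IsValidColPerm toColPerm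
  toColPerm-valid = record
    { perm          = λ i j eq → reading-injective (subst₂ _≡_ (lookup-σ i) (lookup-σ j) eq)
    ; firstBlue     = λ e → trans (lookup-κ _) (minimal⇒blue (first-minimal _ (toℕ-cast (sym e) Fin.zero)))
    ; noBBAscent    = λ i j i⋖j (bi , bj , σi<σj) →
        <-asym (σ-< σi<σj) (minimal-adjacent-descent i⋖j (blue-at bi) (blue-at bj))
    ; noRRDescent   = λ i j i⋖j (ri , rj , σj<σi) →
        <-asym (σ-< σj<σi) (nonMinimal-adjacent-ascent i⋖j (red-at ri) (red-at rj))
    ; noBRInversion = λ i j i<j (bi , rj , σj<σi) →
        <-asym (σ-< σj<σi) (minimal-before-nonMinimal i<j (blue-at bi) (red-at rj)) }
    where
    σ-< : ∀ {i j} → lookup (proj₁ toColPerm) i < lookup (proj₁ toColPerm) j → reading i < reading j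
    σ-< {i} {j} = subst₂ _<_ (lookup-σ i) (lookup-σ j)
    blue-at : ∀ {i} → Blue (lookup (proj₂ toColPerm) i) → ¬ NonMinimal (reading i)
    blue-at {i} b = blue⇒minimal (trans (sym (lookup-κ i)) b)
    red-at : ∀ {i} → Red (lookup (proj₂ toColPerm) i) → NonMinimal (reading i)
    red-at {i} r = red⇒nonMinimal (trans (sym (lookup-κ i)) r)

module Comparability {n} (p : ColPerm n) where
  s : Fin n → Fin n
  s = lookup (proj₁ p)
  c : Fin n → Bool
  c = lookup (proj₂ p)

  BlueBeforeRed : Fin n → Fin n → Set
  BlueBeforeRed x y = ∃₂ λ i j → i < j × s i ≡ x × s j ≡ y × Blue (c i) × Red (c j)

  comparable? : ∀ x y → Dec (x ≡ y ⊎ BlueBeforeRed x y)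
  comparable? x y = x ≟ y ⊎-dec any? λ i → any? λ j →
    i <? j ×-dec s i ≟ x ×-dec s j ≟ y ×-dec c i BoolP.≟ true ×-dec c j BoolP.≟ false

  toRel : Rel n
  toRel = tabulate λ x → tabulate λ y → isYes (comparable? x y)

  toRel-entry : ∀ x y → lookup (lookup toRel x) y ≡ isYes (comparable? x y)
  toRel-entry x y =
    trans (cong (λ row → lookup row y) (VecP.lookup∘tabulate _ x)) (VecP.lookup∘tabulate _ y)

  ≼-toRel⁻ : ∀ {x y} → toRel ⊢ x ≼ y → x ≡ y ⊎ BlueBeforeRed x y
  ≼-toRel⁻ {x} {y} x≼y = toWitness {a? = comparable? x y} (subst T (toRel-entry x y) x≼y)

  ≼-toRel⁺ : ∀ {x y} → x ≡ y ⊎ BlueBeforeRed x y → toRel ⊢ x ≼ y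
  ≼-toRel⁺ {x} {y} h = subst T (sym (toRel-entry x y)) (fromWitness {a? = comparable? x y} h)

  module _ (v : IsValidColPerm p) where
    open IsValidColPerm v
    open Structure toRel

    s-injective : ∀ {i j} → s i ≡ s j → i ≡ j
    s-injective = perm _ _

    s-surjective : ∀ y → ∃ λ i → s i ≡ y
    s-surjective = injective⇒surjective s s-injective

    blue-red-clash : ∀ {i} → Blue (c i) → Red (c i) → ⊥
    blue-red-clash b r with () ← trans (sym b) r

    ≺-toRel⁻ : ∀ {x y} → toRel ⊢ x ≺ y → BlueBeforeRed x y
    ≺-toRel⁻ (x≼y , x≢y) with ≼-toRel⁻ x≼y
    ... | inj₁ x≡y = ⊥-elim (x≢y x≡y)
    ... | inj₂ bbr = bbr

    ≺-toRel⁺ : ∀ {i j} → i < j → Blue (c i) → Red (c j) → toRel ⊢ s i ≺ s j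
    ≺-toRel⁺ {i} {j} i<j bi rj =
      ≼-toRel⁺ (inj₂ (i , j , i<j , refl , refl , bi , rj)) , <⇒≢ i<j ∘ s-injective

    ≺-positions : ∀ {i j} → toRel ⊢ s i ≺ s j → i < j × Blue (c i) × Red (c j)
    ≺-positions si≺sj with ≺-toRel⁻ si≺sj
    ... | i , j , i<j , si≡ , sj≡ , bi , rj with s-injective si≡ | s-injective sj≡
    ...   | refl | refl = i<j , bi , rj

    no-chain : ∀ {x y z} → toRel ⊢ x ≺ y → toRel ⊢ y ≺ z → ⊥
    no-chain x≺y y≺z with ≺-toRel⁻ x≺y | ≺-toRel⁻ y≺z
    ... | _ , j , _ , _ , refl , _ , rj | i , _ , _ , sj≡si , _ , bi , _ with s-injective sj≡si
    ...   | refl = blue-red-clash bi rj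

    ≺⇒< : ∀ x y → toRel ⊢ x ≺ y → x < y
    ≺⇒< x y x≺y with ≺-toRel⁻ x≺y
    ... | i , j , i<j , refl , refl , bi , rj with <-cmp (s i) (s j)
    ...   | tri< si<sj _ _ = si<sj
    ...   | tri≈ _ si≡sj _ = ⊥-elim (proj₂ x≺y si≡sj)
    ...   | tri> _ _ sj<si = ⊥-elim (noBRInversion i j i<j (bi , rj , sj<si))

    ≺-toRel-cross : Crossing
    ≺-toRel-cross a≺b c≺d with ≺-toRel⁻ a≺b | ≺-toRel⁻ c≺d
    ... | i₁ , j₁ , i₁<j₁ , refl , refl , bi₁ , rj₁ | i₂ , j₂ , i₂<j₂ , refl , refl , bi₂ , rj₂
      with <-cmp i₁ j₂ | <-cmp i₂ j₁
    ... | tri< i₁<j₂ _ _ | _              = inj₂ (inj₂ (inj₁ (≺-toRel⁺ i₁<j₂ bi₁ rj₂)))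
    ... | tri≈ _ refl _  | _              = ⊥-elim (blue-red-clash bi₁ rj₂)
    ... | tri> _ _ _     | tri< i₂<j₁ _ _ = inj₂ (inj₂ (inj₂ (≺-toRel⁺ i₂<j₁ bi₂ rj₁)))
    ... | tri> _ _ _     | tri≈ _ refl _  = ⊥-elim (blue-red-clash bi₂ rj₁)
    ... | tri> _ _ j₂<i₁ | tri> _ _ j₁<i₂ =
      ⊥-elim (<-asym (<-trans i₁<j₁ j₁<i₂) (<-trans i₂<j₂ j₂<i₁))

    toRel-is32Poset : Is32Poset toRel
    toRel-is32Poset = record
      { partialOrder = record
        { refl    = ≼-refl
        ; antisym = λ x y x≼y y≼x → antisym (≼⇒≡⊎≺ x≼y) (≼⇒≡⊎≺ y≼x)
        ; trans   = λ x y z x≼y y≼z → ≼-trans (≼⇒≡⊎≺ x≼y) (≼⇒≡⊎≺ y≼z) }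
      ; natural    = ≺⇒<
      ; threeFree  = λ x y z (x≺y , y≺z) → no-chain x≺y y≺z
      ; twoTwoFree = crossing⇒twoTwoFree ≼-refl ≺-toRel-cross }
      where
      ≼-refl : ∀ x → toRel ⊢ x ≼ x
      ≼-refl x = ≼-toRel⁺ (inj₁ refl)
      antisym : ∀ {x y} → x ≡ y ⊎ toRel ⊢ x ≺ y → y ≡ x ⊎ toRel ⊢ y ≺ x → x ≡ y
      antisym (inj₁ x≡y) _          = x≡y
      antisym (inj₂ _)   (inj₁ y≡x) = sym y≡x
      antisym (inj₂ x≺y) (inj₂ y≺x) = ⊥-elim (no-chain x≺y y≺x)
      ≼-trans : ∀ {x y z} → x ≡ y ⊎ toRel ⊢ x ≺ y → y ≡ z ⊎ toRel ⊢ y ≺ z → toRel ⊢ x ≼ z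
      ≼-trans (inj₁ refl) (inj₁ refl) = ≼-refl _
      ≼-trans (inj₁ refl) (inj₂ y≺z)  = proj₁ y≺z
      ≼-trans (inj₂ x≺y)  (inj₁ refl) = proj₁ x≺y
      ≼-trans (inj₂ x≺y)  (inj₂ y≺z)  = ⊥-elim (no-chain x≺y y≺z)

    blue-entry⇒minimal : ∀ {i} → Blue (c i) → ¬ NonMinimal (s i)
    blue-entry⇒minimal bi (w , w≺si) with s-surjective w
    ... | k , refl = blue-red-clash bi (proj₂ (proj₂ (≺-positions w≺si)))

    red-entry⇒nonMinimal : ∀ {j} → Red (c j) → NonMinimal (s j)
    red-entry⇒nonMinimal {j} rj with inhabited⇒suc j
    ... | m , e = s first , ≺-toRel⁺ first<j (firstBlue e) rj
      where
      first = cast (sym e) Fin.zero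
      first<j : first < j
      first<j = ≤∧≢⇒< (subst (ℕ._≤ toℕ j) (sym (toℕ-cast (sym e) Fin.zero)) ℕ.z≤n)
                      (λ { refl → blue-red-clash (firstBlue e) rj })

    ∀-via-s : ∀ {A : Fin n → Set} → (∀ k → A (s k)) → ∀ u → A u
    ∀-via-s f u with s-surjective u
    ... | k , refl = f k

    blue-run-descends : ∀ {i j} → i < j → (∀ {k} → i ≤ k → k ≤ j → Blue (c k)) → s j < s i
    blue-run-descends =
      chain (Blue ∘ c) {λ i j → s j < s i} (λ sj<si sk<sj → <-trans sk<sj sj<si) step
      where
      step : ∀ {i j} → Adjacent i j → Blue (c i) → Blue (c j) → s j < s i
      step {i} {j} i⋖j bi bj with <-cmp (s i) (s j)
      ... | tri< si<sj _ _ = ⊥-elim (noBBAscent i j i⋖j (bi , bj , si<sj))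
      ... | tri≈ _ si≡sj _ = ⊥-elim (<⇒≢ (adjacent⇒< i⋖j) (s-injective si≡sj))
      ... | tri> _ _ sj<si = sj<si

    red-run-ascends : ∀ {i j} → i < j → (∀ {k} → i ≤ k → k ≤ j → Red (c k)) → s i < s j
    red-run-ascends = chain (Red ∘ c) {λ i j → s i < s j} <-trans step
      where
      step : ∀ {i j} → Adjacent i j → Red (c i) → Red (c j) → s i < s j
      step {i} {j} i⋖j ri rj with <-cmp (s i) (s j)
      ... | tri< si<sj _ _ = si<sj
      ... | tri≈ _ si≡sj _ = ⊥-elim (<⇒≢ (adjacent⇒< i⋖j) (s-injective si≡sj))
      ... | tri> _ _ sj<si = ⊥-elim (noRRDescent i j i⋖j (ri , rj , sj<si))

    -- A red entry between i and j is above s i but not s j; without one, s i and s j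
    -- have the same up-set and the blue entries from i to j decrease.
    blue-wider : ∀ {i j} → i < j → Blue (c i) → Blue (c j) → Wider Up (s i) (s j)
    blue-wider {i} {j} i<j bi bj with any? (λ k → i ≤? k ×-dec k ≤? j ×-dec c k BoolP.≟ false)
    ... | yes (k , i≤k , k≤j , rk) =
      strictly (s k) (≺-toRel⁺ (≤∧≢⇒< i≤k λ { refl → blue-red-clash bi rk }) bi rk)
                     (λ sj≺sk → ℕP.<⇒≱ (proj₁ (≺-positions sj≺sk)) k≤j)
    ... | no no-red = equally (∀-via-s i⊆j) (∀-via-s j⊆i) (blue-run-descends i<j all-blue)
      where
      all-blue : ∀ {k} → i ≤ k → k ≤ j → Blue (c k)
      all-blue {k} i≤k k≤j = BoolP.¬-not (λ rk → no-red (k , i≤k , k≤j , rk))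
      i⊆j : ∀ k → toRel ⊢ s i ≺ s k → toRel ⊢ s j ≺ s k
      i⊆j k si≺sk with ≺-positions si≺sk
      ... | i<k , _ , rk = ≺-toRel⁺ (ℕP.≰⇒> λ k≤j → no-red (k , ℕP.<⇒≤ i<k , k≤j , rk)) bj rk
      j⊆i : ∀ k → toRel ⊢ s j ≺ s k → toRel ⊢ s i ≺ s k
      j⊆i k sj≺sk with ≺-positions sj≺sk
      ... | j<k , _ , rk = ≺-toRel⁺ (<-trans i<j j<k) bi rk

    red-wider : ∀ {i j} → i < j → Red (c i) → Red (c j) → Wider Down (s j) (s i)
    red-wider {i} {j} i<j ri rj with any? (λ k → i ≤? k ×-dec k ≤? j ×-dec c k BoolP.≟ true)
    ... | yes (k , i≤k , k≤j , bk) =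
      strictly (s k) (≺-toRel⁺ (≤∧≢⇒< k≤j λ { refl → blue-red-clash bk rj }) bk rj)
                     (λ sk≺si → ℕP.<⇒≱ (proj₁ (≺-positions sk≺si)) i≤k)
    ... | no no-blue = equally (∀-via-s j⊇i) (∀-via-s i⊇j) (red-run-ascends i<j all-red)
      where
      all-red : ∀ {k} → i ≤ k → k ≤ j → Red (c k)
      all-red {k} i≤k k≤j = BoolP.¬-not (λ bk → no-blue (k , i≤k , k≤j , bk))
      j⊇i : ∀ k → toRel ⊢ s k ≺ s j → toRel ⊢ s k ≺ s i
      j⊇i k sk≺sj with ≺-positions sk≺sj
      ... | k<j , bk , _ = ≺-toRel⁺ (ℕP.≰⇒> λ i≤k → no-blue (k , i≤k , ℕP.<⇒≤ k<j , bk)) bk ri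
      i⊇j : ∀ k → toRel ⊢ s k ≺ s i → toRel ⊢ s k ≺ s j
      i⊇j k sk≺si with ≺-positions sk≺si
      ... | k<i , bk , _ = ≺-toRel⁺ (<-trans k<i i<j) bk rj

    s-monotone : s Preserves _<_ ⟶ Before
    s-monotone {i} {j} i<j with c i in ci | c j in cj
    ... | true  | true  = blue-blue (blue-entry⇒minimal ci) (blue-entry⇒minimal cj) (blue-wider i<j ci cj)
    ... | true  | false = blue-red (blue-entry⇒minimal ci) (red-entry⇒nonMinimal cj) (≺-toRel⁺ i<j ci cj)
    ... | false | true  = red-blue (red-entry⇒nonMinimal ci) (blue-entry⇒minimal cj)
                                   (λ sj≺si → <-asym i<j (proj₁ (≺-positions sj≺si)))
    ... | false | false = red-red (red-entry⇒nonMinimal ci) (red-entry⇒nonMinimal cj) (red-wider i<j ci cj)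

toColPerm-cong : ∀ {n} (R : Rel n) (pf₁ pf₂ : Is32Poset R) →
                 Reading.toColPerm R pf₁ ≡ Reading.toColPerm R pf₂
toColPerm-cong R pf₁ pf₂ =
  cong₂ _,_ (VecP.tabulate-cong same-reading) (VecP.tabulate-cong (cong (Structure.colour R) ∘ same-reading))
  where
  open Reading R pf₂ using (reading-monotone; reading-surjective)
  same-reading = Reading.reading-unique R pf₁ reading-monotone reading-surjective

toColPerm∘toRel : ∀ {n} (p : ColPerm n) (v : IsValidColPerm p) (pf : Is32Poset (Comparability.toRel p)) →
                  Reading.toColPerm (Comparability.toRel p) pf ≡ p
toColPerm∘toRel p v pf =
  cong₂ _,_ (trans (VecP.tabulate-cong reading≗s) (VecP.tabulate∘lookup (proj₁ p)))
            (trans (VecP.tabulate-cong colour∘reading≗c) (VecP.tabulate∘lookup (proj₂ p)))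
  where
  open Comparability p
  open Structure toRel
  open Reading toRel pf using (reading; reading-unique)
  reading≗s = reading-unique (s-monotone v) (s-surjective v)
  colour-s : ∀ k → colour (s k) ≡ c k
  colour-s k with c k in ck
  ... | true  = minimal⇒blue (blue-entry⇒minimal v ck)
  ... | false = nonMinimal⇒red (red-entry⇒nonMinimal v ck)
  colour∘reading≗c : ∀ k → colour (reading k) ≡ c k
  colour∘reading≗c k = trans (cong colour (reading≗s k)) (colour-s k)

toRel∘toColPerm : ∀ {n} (R : Rel n) (pf : Is32Poset R) → Comparability.toRel (Reading.toColPerm R pf) ≡ R
toRel∘toColPerm R pf =
  trans (VecP.tabulate-cong (λ x → trans (VecP.tabulate-cong (entry x)) (VecP.tabulate∘lookup (lookup R x))))
        (VecP.tabulate∘lookup R)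
  where
  open Structure R
  open Properties pf
  open Reading R pf
  open Comparability toColPerm using (BlueBeforeRed; comparable?)
  sound : ∀ {x y} → x ≡ y ⊎ BlueBeforeRed x y → R ⊢ x ≼ y
  sound (inj₁ refl) = IsPartialOrder.refl (Is32Poset.partialOrder pf) _
  sound (inj₂ (i , j , i<j , refl , refl , bi , rj))
    rewrite lookup-σ i | lookup-σ j =
    proj₁ (before-blue-red⇒≺ (reading-monotone i<j) (blue⇒minimal (trans (sym (lookup-κ i)) bi))
                                                    (red⇒nonMinimal (trans (sym (lookup-κ j)) rj)))
  complete : ∀ {x y} → R ⊢ x ≼ y → x ≡ y ⊎ BlueBeforeRed x y
  complete {x} {y} x≼y with ≼⇒≡⊎≺ x≼y
  ... | inj₁ x≡y = inj₁ x≡y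
  ... | inj₂ x≺y with reading-surjective x | reading-surjective y
  ...   | i , refl | j , refl = inj₂ (i , j , reading-reflects (≺⇒before x≺y) , lookup-σ i , lookup-σ j ,
                                      trans (lookup-κ i) (minimal⇒blue (≺⇒minimal x≺y)) ,
                                      trans (lookup-κ j) (nonMinimal⇒red (_ , x≺y)))
  entry : ∀ x y → isYes (comparable? x y) ≡ lookup (lookup R x) y
  entry x y =
    trans (isYes≗does (comparable? x y)) (does-⇔ (mk⇔ sound complete) (comparable? x y) (T? _))

inverse : ∀ n → Inverse (PosetSetoid n) (ColPermSetoid n)
inverse n = record
  { to        = λ (R , pf) → Reading.toColPerm R pf , Reading.toColPerm-valid R pf
  ; from      = λ (p , v) → Comparability.toRel p , Comparability.toRel-is32Poset p v
  ; to-cong   = λ { {R , pf₁} {.R , pf₂} refl → toColPerm-cong R pf₁ pf₂ }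
  ; from-cong = λ { refl → refl }
  ; inverse   = (λ { {p , v} {.(Comparability.toRel p) , pf} refl → toColPerm∘toRel p v pf })
              , (λ { {R , pf} {.(Reading.toColPerm R pf) , _} refl → toRel∘toColPerm R pf }) }

proposition3p3 : (n : ℕ) → n ≥ 1 → Bijection (PosetSetoid n) (ColPermSetoid n)
proposition3p3 n _ = Inverse⇒Bijection (inverse n)
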